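{- Let $b$ be a positive integer, let $G$ be a graph with no induced subgraph isomorphic to $H(1,b,0)$, let $H$ be an induced subgraph of $G$ isomorphic to $K_{1,2b-1}$, and let $M$ be a connected induced subgraph of $G$ such that $M$ and $H$ are vertex-disjoint and no vertex of $M$ is adjacent to a vertex of $H$. Then no vertex of $G$ simultaneously has a neighbor in $H$, a neighbor in $M$, and a non-neighbor in $M$.
   Context: $K_{1,2b-1}$ is the star with $2b-1$ leaves. For non-negative integers $a_t,\dots,a_0$ with $a_t>0$, $H(a_t,\dots,a_1,a_0)$ is the disjoint union of an independent set of size $a_0$ with the subdivided star obtained from a center vertex by attaching, for each $i$, $a_i$ internally disjoint paths of length $i$. Thus $H(1,b,0)$ is a center with $b$ pendant leaves and one pendant path of length 2. -}

module Defs where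

open import Data.Nat using (ℕ; zero; suc; _+_; _*_; _∸_)
open import Data.Fin using (Fin; zero; suc)
open import Data.Bool using (Bool; true; false; T)
open import Data.Empty using (⊥)
open import Data.Product using (Σ; ∃; _×_; _,_)
open import Relation.Nullary using (¬_)
open import Relation.Binary.PropositionalEquality using (_≡_; _≢_; refl)
open import Function.Definitions using (Injective)

record Graph : Set₁ where
  field
    n      : ℕ
    Adj    : Fin n → Fin n → Set
    sym    : ∀ {u v} → Adj u v → Adj v u
    irrefl : ∀ {v} → ¬ Adj v v
  V : Set
  V = Fin n

open Graph public

record InducedCopy (H G : Graph) : Set where
  field
    emb      : V H → V G
    inj      : Injective _≡_ _≡_ emb
    adj-pres : ∀ u v → Adj H u v → Adj G (emb u) (emb v)
    adj-refl : ∀ u v → Adj G (emb u) (emb v) → Adj H u v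

open InducedCopy public

Contains : Graph → Graph → Set
Contains G H = InducedCopy H G

-- The star K_{1,k}: vertex zero is the center, suc i are the k leaves.

starAdj : ∀ {k} → Fin (suc k) → Fin (suc k) → Bool
starAdj zero    (suc _) = true
starAdj (suc _) zero    = true
starAdj _       _       = false

starSym : ∀ {k} (u v : Fin (suc k)) → T (starAdj u v) → T (starAdj v u)
starSym zero    (suc _) t = t
starSym (suc _) zero    t = t

starIrr : ∀ {k} (v : Fin (suc k)) → ¬ T (starAdj v v)
starIrr zero    ()
starIrr (suc _) ()

Star : ℕ → Graph
Star k = record
  { n = suc k
  ; Adj = λ u v → T (starAdj u v)
  ; sym = λ {u} {v} → starSym u v
  ; irrefl = λ {v} → starIrr v }

K1 : ℕ → Graph
K1 b = Star (2 * b ∸ 1)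

-- H(1,b,0): center 0, a path 0 - 1 - 2 of length 2, and b pendant
-- leaves suc (suc (suc i)) attached to 0.

hAdj : ∀ {b} → Fin (3 + b) → Fin (3 + b) → Bool
hAdj zero                   (suc zero)             = true
hAdj zero                   (suc (suc (suc _)))    = true
hAdj (suc zero)             zero                   = true
hAdj (suc zero)             (suc (suc zero))       = true
hAdj (suc (suc zero))       (suc zero)             = true
hAdj (suc (suc (suc _)))    zero                   = true
hAdj _                      _                      = false

hSym : ∀ {b} (u v : Fin (3 + b)) → T (hAdj u v) → T (hAdj v u)
hSym zero                (suc zero)          t = t
hSym zero                (suc (suc (suc _))) t = t
hSym (suc zero)          zero                t = t
hSym (suc zero)          (suc (suc zero))    t = t
hSym (suc (suc zero))    (suc zero)          t = t
hSym (suc (suc (suc _))) zero                t = t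

hIrr : ∀ {b} (v : Fin (3 + b)) → ¬ T (hAdj v v)
hIrr zero                ()
hIrr (suc zero)          ()
hIrr (suc (suc zero))    ()
hIrr (suc (suc (suc _))) ()

H1b0 : ℕ → Graph
H1b0 b = record
  { n = 3 + b
  ; Adj = λ u v → T (hAdj {b} u v)
  ; sym = λ {u} {v} → hSym u v
  ; irrefl = λ {v} → hIrr v }

VSet : Graph → Set₁
VSet G = V G → Set

data WalkIn (G : Graph) (M : VSet G) : V G → V G → Set where
  here : ∀ {u} → M u → WalkIn G M u u
  step : ∀ {u w v} → M u → Adj G u w → WalkIn G M w v → WalkIn G M u v

Connected : (G : Graph) → VSet G → Set
Connected G M = (∃ λ v → M v) × (∀ u v → M u → M v → WalkIn G M u v)

module Submission where

-- Since M is connected, some edge u–w of M has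
-- x ~ u and x ≁ w.  By pigeonhole on the 2b-1 = (b + b) - 1 leaves, x
-- sees b leaves or misses b leaves.  In each case b independent leaves together with a path of
-- length two form an induced H(1,b,0), a "spider":
--   * x sees b leaves: centre x, path x–u–w;
--   * x misses b leaves and sees the centre c: centre c, path c–x–u;
--   * x misses b leaves and the centre, but sees a leaf l: path c–l–x.
-- Here M being anticomplete to H keeps u and w away from the star.
--
-- Adjacency to x is decidable only
-- classically, but since the claim is a negation we may assume it.

open import Defs
open import Data.Nat using (ℕ; _≥_; zero; suc; _+_; _*_; _∸_)
open import Data.Nat.Properties using (+-suc; +-identityʳ; suc-injective; 0≢1+n)
open import Data.Fin using (Fin; zero; suc)
import Data.Fin.Properties as Fin
open import Data.Product using (Σ; ∃; _×_; _,_)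
open import Data.Sum using (_⊎_; inj₁; inj₂)
import Data.Sum as Sum
open import Data.Unit using (tt)
open import Data.Empty using (⊥-elim)
open import Effect.Monad using (RawMonad)
open import Function using (_∘_)
open import Function.Definitions using (Injective)
open import Relation.Nullary using (¬_; Dec; yes; no)
open import Relation.Nullary.Decidable using (¬¬-excluded-middle)
open import Relation.Nullary.Negation using (¬¬-Monad)
open import Relation.Unary using (Decidable)
open import Relation.Binary.PropositionalEquality
  using (_≡_; _≢_; refl; cong; subst; trans) renaming (sym to ≡-sym)

¬¬-decidable : ∀ {m} (P : Fin m → Set) → ¬ ¬ Decidable P
¬¬-decidable P = Fin.sequence (RawMonad.rawApplicative ¬¬-Monad) (λ _ → ¬¬-excluded-middle)

merged-share-neighbours : (H G : Graph) (f : V H → V G)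
  → (∀ u v → Adj H u v → Adj G (f u) (f v))
  → (∀ u v → Adj G (f u) (f v) → Adj H u v)
  → ∀ u v w → f u ≡ f v → Adj H u w → Adj H v w
merged-share-neighbours H G f preserve reflect u v w fu≡fv u~w =
  reflect v w (subst (λ z → Adj G z (f w)) fu≡fv (preserve u w u~w))

record Spider (G : Graph) (k : ℕ) : Set where
  field
    centre joint tip : V G
    leaf             : Fin k → V G
    leaf-injective   : Injective _≡_ _≡_ leaf
    centre~joint     : Adj G centre joint
    joint~tip        : Adj G joint tip
    centre~leaf      : ∀ j → Adj G centre (leaf j)
    centre≁tip       : ¬ Adj G centre tip
    joint≁leaf       : ∀ j → ¬ Adj G joint (leaf j)
    tip≁leaf         : ∀ j → ¬ Adj G tip (leaf j)
    leaf≁leaf        : ∀ j j′ → ¬ Adj G (leaf j) (leaf j′)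

pattern hub       = zero
pattern knee      = suc zero
pattern foot      = suc (suc zero)
pattern pendant j = suc (suc (suc j))

spider-copy : ∀ {G b} → Spider G (suc b) → Contains G (H1b0 (suc b))
spider-copy {G} {b} S = record
  { emb = vertex ; inj = injective ; adj-pres = preserve ; adj-refl = reflect }
  where
    open Spider S
    H : Graph
    H = H1b0 (suc b)

    vertex : V H → V G
    vertex hub         = centre
    vertex knee        = joint
    vertex foot        = tip
    vertex (pendant j) = leaf j

    preserve : ∀ u v → Adj H u v → Adj G (vertex u) (vertex v)
    preserve hub         knee        _ = centre~joint
    preserve hub         (pendant j) _ = centre~leaf j
    preserve knee        hub         _ = sym G centre~joint
    preserve knee        foot        _ = joint~tip
    preserve foot        knee        _ = sym G joint~tip
    preserve (pendant j) hub         _ = sym G (centre~leaf j)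

    reflect : ∀ u v → Adj G (vertex u) (vertex v) → Adj H u v
    reflect hub         hub         a = irrefl G a
    reflect hub         knee        _ = tt
    reflect hub         foot        a = centre≁tip a
    reflect hub         (pendant j) _ = tt
    reflect knee        hub         _ = tt
    reflect knee        knee        a = irrefl G a
    reflect knee        foot        _ = tt
    reflect knee        (pendant j) a = joint≁leaf j a
    reflect foot        hub         a = centre≁tip (sym G a)
    reflect foot        knee        _ = tt
    reflect foot        foot        a = irrefl G a
    reflect foot        (pendant j) a = tip≁leaf j a
    reflect (pendant j) hub         _ = tt
    reflect (pendant j) knee        a = joint≁leaf j (sym G a)
    reflect (pendant j) foot        a = tip≁leaf j (sym G a)
    reflect (pendant j) (pendant k) a = leaf≁leaf j k a

    -- Two distinct vertices of H are told apart by a neighbour w (adjacent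
    -- to the first only), except two pendants, separated by leaf-injective.
    share : ∀ u v w → vertex u ≡ vertex v → Adj H u w → Adj H v w
    share = merged-share-neighbours H G vertex preserve reflect

    injective : Injective _≡_ _≡_ vertex
    injective {hub}       {hub}       _ = refl
    injective {hub}       {knee}      e = ⊥-elim (share hub knee knee e tt)
    injective {hub}       {foot}      e = ⊥-elim (share hub foot (pendant zero) e tt)
    injective {hub}       {pendant j} e = ⊥-elim (share hub (pendant j) knee e tt)
    injective {knee}      {hub}       e = ⊥-elim (share hub knee knee (≡-sym e) tt)
    injective {knee}      {knee}      _ = refl
    injective {knee}      {foot}      e = ⊥-elim (share knee foot foot e tt)
    injective {knee}      {pendant j} e = ⊥-elim (share knee (pendant j) foot e tt)
    injective {foot}      {hub}       e = ⊥-elim (share hub foot (pendant zero) (≡-sym e) tt)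
    injective {foot}      {knee}      e = ⊥-elim (share knee foot foot (≡-sym e) tt)
    injective {foot}      {foot}      _ = refl
    injective {foot}      {pendant j} e = ⊥-elim (share foot (pendant j) knee e tt)
    injective {pendant j} {hub}       e = ⊥-elim (share hub (pendant j) knee (≡-sym e) tt)
    injective {pendant j} {knee}      e = ⊥-elim (share knee (pendant j) foot (≡-sym e) tt)
    injective {pendant j} {foot}      e = ⊥-elim (share foot (pendant j) knee (≡-sym e) tt)
    injective {pendant j} {pendant k} e = cong pendant (leaf-injective e)

boundary-edge : ∀ {G M} (P : V G → Set) → Decidable P → ∀ {a z}
  → WalkIn G M a z → P a → ¬ P z
  → Σ (V G) λ u → Σ (V G) λ w → M u × M w × Adj G u w × P u × ¬ P w
boundary-edge P P? (here _) Pa ¬Pz = ⊥-elim (¬Pz Pa)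
boundary-edge P P? {a} (step Ma a~b walk) Pa ¬Pz with P? _
... | yes Pb = boundary-edge P P? walk Pb ¬Pz
... | no ¬Pb = a , _ , Ma , start walk , a~b , Pa , ¬Pb
  where
    start : ∀ {G M b z} → WalkIn G M b z → M b
    start (here Mb)     = Mb
    start (step Mb _ _) = Mb

record Selection {m} (P : Fin m → Set) (p : ℕ) : Set where
  field
    pick           : Fin p → Fin m
    pick-injective : Injective _≡_ _≡_ pick
    picked         : ∀ j → P (pick j)

open Selection

none : ∀ {m} {P : Fin m → Set} → Selection P zero
none = record { pick = λ () ; pick-injective = λ {} ; picked = λ () }

cons : ∀ {m p} {P : Fin (suc m) → Set} → P zero → Selection (P ∘ suc) p → Selection P (suc p)
cons {m} {p} {P} P0 S = record { pick = pick′ ; pick-injective = injective ; picked = picked′ }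
  where
    pick′ : Fin (suc p) → Fin (suc m)
    pick′ zero    = zero
    pick′ (suc j) = suc (pick S j)

    injective : Injective _≡_ _≡_ pick′
    injective {zero}  {zero}  _  = refl
    injective {zero}  {suc _} ()
    injective {suc _} {zero}  ()
    injective {suc j} {suc k} e  = cong suc (pick-injective S (Fin.suc-injective e))

    picked′ : ∀ j → P (pick′ j)
    picked′ zero    = P0
    picked′ (suc j) = picked S j

shift : ∀ {m p} {P : Fin (suc m) → Set} → Selection (P ∘ suc) p → Selection P p
shift S = record
  { pick = suc ∘ pick S
  ; pick-injective = pick-injective S ∘ Fin.suc-injective
  ; picked = picked S }

pigeonhole : ∀ {m} (P : Fin m → Set) → Decidable P → ∀ p q → p + q ≡ suc m
  → Selection P p ⊎ Selection (¬_ ∘ P) q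
pigeonhole P P? zero    q       _ = inj₁ none
pigeonhole P P? (suc p) zero    _ = inj₂ none
pigeonhole {zero} P P? (suc p) (suc q) e =
  ⊥-elim (0≢1+n (≡-sym (trans (≡-sym (+-suc p q)) (suc-injective e))))
pigeonhole {suc m} P P? (suc p) (suc q) e with P? zero
... | yes P0 = Sum.map (cons P0) shift
                 (pigeonhole (P ∘ suc) (P? ∘ suc) p (suc q) (suc-injective e))
... | no ¬P0 = Sum.map shift (cons ¬P0)
                 (pigeonhole (P ∘ suc) (P? ∘ suc) (suc p) q
                   (trans (≡-sym (+-suc p q)) (suc-injective e)))

leaves-split : ∀ b → suc b + suc b ≡ suc (2 * suc b ∸ 1)
leaves-split b = cong (λ k → suc (b + suc k)) (≡-sym (+-identityʳ b))

module StarSpiders {G : Graph} {k : ℕ} (H : InducedCopy (Star k) G) where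

  centre : V G
  centre = emb H zero

  leaf : Fin k → V G
  leaf l = emb H (suc l)

  centre~leaf : ∀ l → Adj G centre (leaf l)
  centre~leaf l = adj-pres H zero (suc l) tt

  leaf≁leaf : ∀ l l′ → ¬ Adj G (leaf l) (leaf l′)
  leaf≁leaf l l′ = adj-refl H (suc l) (suc l′)

  legs : ∀ {p} {P : Fin k → Set} → Selection P p → Fin p → V G
  legs S = leaf ∘ pick S

  legs-injective : ∀ {p P} (S : Selection P p) → Injective _≡_ _≡_ (legs S)
  legs-injective S = pick-injective S ∘ Fin.suc-injective ∘ inj H

  Far : V G → Set
  Far v = ∀ i → ¬ Adj G (emb H i) v

  spider-at : ∀ {p x u w} → Selection (Adj G x ∘ leaf) p
    → Adj G x u → Adj G u w → ¬ Adj G x w → Far u → Far w → Spider G p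
  spider-at {x = x} {u} {w} S x~u u~w x≁w far-u far-w = record
    { centre = x ; joint = u ; tip = w ; leaf = legs S
    ; leaf-injective = legs-injective S
    ; centre~joint = x~u ; joint~tip = u~w ; centre~leaf = picked S
    ; centre≁tip = x≁w
    ; joint≁leaf = λ j a → far-u (suc (pick S j)) (sym G a)
    ; tip≁leaf = λ j a → far-w (suc (pick S j)) (sym G a)
    ; leaf≁leaf = λ j j′ → leaf≁leaf (pick S j) (pick S j′) }

  spider-through : ∀ {p x u} → Selection (¬_ ∘ Adj G x ∘ leaf) p
    → Adj G centre x → Adj G x u → Far u → Spider G p
  spider-through {x = x} {u} S c~x x~u far-u = record
    { centre = centre ; joint = x ; tip = u ; leaf = legs S
    ; leaf-injective = legs-injective S
    ; centre~joint = c~x ; joint~tip = x~u ; centre~leaf = centre~leaf ∘ pick S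
    ; centre≁tip = far-u zero
    ; joint≁leaf = picked S
    ; tip≁leaf = λ j a → far-u (suc (pick S j)) (sym G a)
    ; leaf≁leaf = λ j j′ → leaf≁leaf (pick S j) (pick S j′) }

  spider-beyond : ∀ {p x} l → Selection (¬_ ∘ Adj G x ∘ leaf) p
    → Adj G (leaf l) x → ¬ Adj G centre x → Spider G p
  spider-beyond {x = x} l S l~x c≁x = record
    { centre = centre ; joint = leaf l ; tip = x ; leaf = legs S
    ; leaf-injective = legs-injective S
    ; centre~joint = centre~leaf l ; joint~tip = l~x ; centre~leaf = centre~leaf ∘ pick S
    ; centre≁tip = c≁x
    ; joint≁leaf = λ j → leaf≁leaf l (pick S j)
    ; tip≁leaf = picked S
    ; leaf≁leaf = λ j j′ → leaf≁leaf (pick S j) (pick S j′) }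

  spider-missing : ∀ {p x u} i → Selection (¬_ ∘ Adj G x ∘ leaf) p
    → Adj G x (emb H i) → Dec (Adj G x centre) → Adj G x u → Far u → Spider G p
  spider-missing i       S _   (yes x~c) x~u far-u = spider-through S (sym G x~c) x~u far-u
  spider-missing zero    S x~c (no x≁c)  _   _     = ⊥-elim (x≁c x~c)
  spider-missing (suc l) S x~l (no x≁c)  _   _     = spider-beyond l S (sym G x~l) (x≁c ∘ sym G)

lemma13 : (b : ℕ) → b ≥ 1 → (G : Graph) → ¬ Contains G (H1b0 b)
    → (H : InducedCopy (K1 b) G)
    → (M : VSet G) → Connected G M
    → (∀ i v → M v → emb H i ≢ v)
    → (∀ i v → M v → ¬ Adj G (emb H i) v)
    → ¬ (Σ (V G) λ x → (∃ λ i → Adj G x (emb H i)) × (∃ λ u → M u × Adj G x u) × (∃ λ u → M u × u ≢ x × ¬ Adj G x u))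
lemma13 (suc b) _ G no-H1b0 H M (_ , connected) _ anticomplete
        (x , (i , x~Hi) , (u₀ , Mu₀ , x~u₀) , (w₀ , Mw₀ , _ , x≁w₀)) =
  ¬¬-decidable (Adj G x) spider
  where
    open StarSpiders H

    spider : ¬ Decidable (Adj G x)
    spider x? with boundary-edge (Adj G x) x? (connected u₀ w₀ Mu₀ Mw₀) x~u₀ x≁w₀
    ... | u , w , Mu , Mw , u~w , x~u , x≁w
        with pigeonhole (Adj G x ∘ leaf) (x? ∘ leaf) (suc b) (suc b) (leaves-split b)
    ... | inj₁ seen   = no-H1b0 (spider-copy
          (spider-at seen x~u u~w x≁w (λ j → anticomplete j u Mu) (λ j → anticomplete j w Mw)))
    ... | inj₂ missed = no-H1b0 (spider-copy
          (spider-missing i missed x~Hi (x? centre) x~u (λ j → anticomplete j u Mu)))
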